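{- Let $(a_n)_{n\in\mathbf{N}}$ be a sequence in $\mathcal{C}$ with palindromic length sequence $pl=pl_a$. Then for all $k\ge0$: $pl(4k)\le pl(4k+3)+2$, $pl(4k+1)\le pl(4k+3)+2$, and $pl(4k+2)\le pl(4k+3)+1$.
   Context: A word is a palindrome if it equals its reversal; $|w|_{pal}$ is the least number of palindromes whose concatenation is $w$. For a sequence $(a_n)$, $pl_a(n)=|a_0a_1\cdots a_n|_{pal}$. The class $\mathcal{C}$: let $\Sigma$ be an alphabet with at least two letters and $a\in\Sigma$. For a bijection $g$ of $\Sigma$ and a word $u$, $g(u)$ is the letter-by-letter image. Let $(f_n)_{n\ge0}$ be bijections of $\Sigma$ and define $w_0=a$, $w_n=w_{n-1}f_{n-1}(w_{n-1})f_{n-1}(w_{n-1})w_{n-1}$ for $n>0$, with the requirement $f_n(w_n)\neq w_n$ for all $n\ge0$. The limit infinite sequence is in $\mathcal{C}$; $\mathcal{C}$ is the set of all such limits. -}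

module Defs where

open import Data.Nat using (ℕ; zero; suc; _≤_)
open import Data.Fin using (Fin)
open import Data.List using (List; []; _∷_; _++_; reverse; map; concat; length; upTo)
open import Data.List.Relation.Unary.All using (All)
open import Data.Fin.Permutation using (Permutation′; _⟨$⟩ʳ_)
open import Data.Product using (Σ; _×_)
open import Relation.Binary.PropositionalEquality using (_≡_)

IsPalindrome : ∀ {A : Set} → List A → Set
IsPalindrome w = reverse w ≡ w

PalFactorisation : ∀ {A : Set} → List A → Set
PalFactorisation {A} w = Σ (List (List A)) λ ps → All IsPalindrome ps × concat ps ≡ w

PalLength : ∀ {A : Set} → List A → ℕ → Set
PalLength {A} w k =
  Σ (List (List A)) (λ ps → All IsPalindrome ps × concat ps ≡ w × length ps ≡ k)
  × ((ps : List (List A)) → All IsPalindrome ps → concat ps ≡ w → k ≤ length ps)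

image : ∀ {n} → Permutation′ n → List (Fin n) → List (Fin n)
image g u = map (g ⟨$⟩ʳ_) u

wseq : ∀ {n} → Fin n → (ℕ → Permutation′ n) → ℕ → List (Fin n)
wseq x f zero = x ∷ []
wseq x f (suc k) = wseq x f k ++ image (f k) (wseq x f k) ++ image (f k) (wseq x f k) ++ wseq x f k

prefix : ∀ {A : Set} → (ℕ → A) → ℕ → List A
prefix a m = map a (upTo m)

-- The sequence a is in the class C (over the alphabet Fin n): there are a
-- letter x and bijections f_k with f_k(w_k) ≠ w_k for all k, and a is the
-- limit of the w_k, i.e. every w_k is a prefix of a.
InClassC : ∀ {n} → (ℕ → Fin n) → Set
InClassC {n} a =
  Σ (Fin n) λ x → Σ (ℕ → Permutation′ n) λ f →
    ((k : ℕ) → (image (f k) (wseq x f k) ≡ wseq x f k → Data.Empty.⊥))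
    × ((k : ℕ) → prefix a (length (wseq x f k)) ≡ wseq x f k)
  where import Data.Empty

-- Every aligned block of four letters of a sequence in C has the shape b c c d:
-- w₁ = x g(x) g(x) x, and wₙ₊₁ = wₙ g(wₙ) g(wₙ) wₙ is a concatenation of
-- letter-by-letter images of wₙ, whose length is divisible by 4 for n ≥ 1.
-- Hence a(4k+2) = a(4k+1) and the prefix of length 4k+4 ends in y y z (only this
-- shape is used, not the condition fₙ(wₙ) ≠ wₙ nor the size of the alphabet).
-- Cut the last one, two or three letters off an optimal palindromic
-- factorisation of that prefix. Factors before the cut survive; the factor
-- straddling the cut leaves a prefix s of a palindrome s t, with t a prefix of
-- the removed suffix. Either |s| ≤ |t|, or s = reverse(t) q with q a
-- palindrome, so s needs at most |t| + 1 palindromes, and only 3 when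
-- t = y y z since reverse(t) = z · y y.
module Submission where

open import Defs
open import Data.Nat using (ℕ; zero; suc; _+_; _*_; _≤_; _<_; z≤n; s≤s)
open import Data.Nat.Properties
  using (≤-trans; ≤-refl; ≤-reflexive; <⇒≤; ≤-<-trans; n≤1+n; +-comm; +-assoc; +-suc; *-suc; +-monoˡ-≤; m≤n+m; m<m+n; module ≤-Reasoning)
open import Data.Fin using (Fin)
open import Data.Fin.Permutation using (Permutation′; _⟨$⟩ʳ_)
open import Function using (_∘′_)
open import Data.Product using (Σ; _×_; _,_; proj₁; proj₂)
open import Data.Sum using (_⊎_; inj₁; inj₂)
open import Data.Unit using (⊤; tt)
open import Data.Empty using (⊥)
open import Data.List using (List; []; _∷_; _++_; _∷ʳ_; [_]; reverse; map; concat; length; upTo)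
open import Data.List.Properties
  using (++-assoc; ++-identityʳ; ++-cancelʳ; reverse-++; reverse-involutive; length-reverse;
         length-++; length-map; length-++-≤ˡ; concat-++; map-++; upTo-∷ʳ; map-applyUpTo; map-upTo;
         ∷-injectiveˡ; ∷-injectiveʳ)
open import Data.List.Relation.Unary.All using (All; []; _∷_)
open import Data.List.Relation.Unary.All.Properties using (++⁺)
open import Relation.Binary.PropositionalEquality using (_≡_; refl; sym; trans; cong; cong₂; subst; subst₂; module ≡-Reasoning)

module _ {A : Set} where

  ++-overlap : ∀ (p r w t : List A) → p ++ r ≡ w ++ t →
    (Σ (List A) λ v → w ≡ p ++ v × r ≡ v ++ t) ⊎ (Σ (List A) λ t₁ → p ≡ w ++ t₁ × t ≡ t₁ ++ r)
  ++-overlap []      r w       t eq = inj₁ (w , refl , eq)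
  ++-overlap (x ∷ p) r []      t eq = inj₂ (x ∷ p , refl , sym eq)
  ++-overlap (x ∷ p) r (y ∷ w) t eq with ∷-injectiveˡ eq | ++-overlap p r w t (∷-injectiveʳ eq)
  ... | refl | inj₁ (v , w≡pv , r≡vt)   = inj₁ (v , cong (x ∷_) w≡pv , r≡vt)
  ... | refl | inj₂ (t₁ , p≡wt₁ , t≡t₁r) = inj₂ (t₁ , cong (x ∷_) p≡wt₁ , t≡t₁r)

  palindrome-++⁻ : ∀ (s t : List A) → IsPalindrome (s ++ t) →
    (Σ (List A) λ u → reverse t ≡ s ++ u) ⊎ (Σ (List A) λ q → s ≡ reverse t ++ q × IsPalindrome q)
  palindrome-++⁻ s t pal with ++-overlap (reverse t) (reverse s) s t (trans (sym (reverse-++ s t)) pal)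
  ... | inj₂ (u , rt≡su , _) = inj₁ (u , rt≡su)
  ... | inj₁ (q , s≡rtq , rs≡qt) = inj₂ (q , s≡rtq , ++-cancelʳ t (reverse q) q (trans (sym rs≡rqt) rs≡qt))
    where
    rs≡rqt : reverse s ≡ reverse q ++ t
    rs≡rqt = begin
      reverse s                           ≡⟨ cong reverse s≡rtq ⟩
      reverse (reverse t ++ q)            ≡⟨ reverse-++ (reverse t) q ⟩
      reverse q ++ reverse (reverse t)    ≡⟨ cong (reverse q ++_) (reverse-involutive t) ⟩
      reverse q ++ t                      ∎
      where open ≡-Reasoning

  PalLength≤ : List A → ℕ → Set
  PalLength≤ w b = Σ (List (List A)) λ ps → All IsPalindrome ps × concat ps ≡ w × length ps ≤ b

  palLength⇒palLength≤ : ∀ {w k} → PalLength w k → PalLength≤ w k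
  palLength⇒palLength≤ ((ps , pal , eq , len) , _) = ps , pal , eq , ≤-reflexive len

  palLength-least : ∀ {w k b} → PalLength w k → PalLength≤ w b → k ≤ b
  palLength-least (_ , least) (ps , pal , eq , len) = ≤-trans (least ps pal eq) len

  palLength≤-mono : ∀ {w b c} → b ≤ c → PalLength≤ w b → PalLength≤ w c
  palLength≤-mono b≤c (ps , pal , eq , len) = ps , pal , eq , ≤-trans len b≤c

  palLength≤-length : ∀ (w : List A) → PalLength≤ w (length w)
  palLength≤-length []      = [] , [] , refl , z≤n
  palLength≤-length (x ∷ w) with palLength≤-length w
  ... | ps , pal , eq , len = [ x ] ∷ ps , refl ∷ pal , cong (x ∷_) eq , s≤s len

  palLength≤-++-palindrome : ∀ {w b} q → IsPalindrome q → PalLength≤ w b → PalLength≤ (w ++ q) (suc b)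
  palLength≤-++-palindrome {w} {b} q palq (ps , pal , eq , len) =
    ps ∷ʳ q , ++⁺ pal (palq ∷ []) , concat-∷ʳ , length-∷ʳ
    where
    open ≡-Reasoning
    concat-∷ʳ : concat (ps ∷ʳ q) ≡ w ++ q
    concat-∷ʳ = begin
      concat (ps ∷ʳ q)        ≡⟨ concat-++ ps [ q ] ⟨
      concat ps ++ (q ++ [])  ≡⟨ cong₂ _++_ eq (++-identityʳ q) ⟩
      w ++ q                  ∎
    length-∷ʳ : length (ps ∷ʳ q) ≤ suc b
    length-∷ʳ = ≤-trans (≤-reflexive (trans (length-++ ps) (+-comm (length ps) 1))) (s≤s len)

  palLength≤-prefixOfPalindrome : ∀ {s t b} → IsPalindrome (s ++ t) →
    PalLength≤ (reverse t) b → length t ≤ suc b → PalLength≤ s (suc b)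
  palLength≤-prefixOfPalindrome {s} {t} pal rt-fact |t|≤ with palindrome-++⁻ s t pal
  ... | inj₁ (u , rt≡su) = palLength≤-mono (≤-trans |s|≤|t| |t|≤) (palLength≤-length s)
    where
    |s|≤|t| : length s ≤ length t
    |s|≤|t| = ≤-trans (length-++-≤ˡ s) (≤-reflexive (trans (cong length (sym rt≡su)) (length-reverse t)))
  ... | inj₂ (q , refl , palq) = palLength≤-++-palindrome q palq rt-fact

  palLength≤-prefixOfPalindrome-length : ∀ {s t} → IsPalindrome (s ++ t) → PalLength≤ s (suc (length t))
  palLength≤-prefixOfPalindrome-length {t = t} pal =
    palLength≤-prefixOfPalindrome pal
      (palLength≤-mono (≤-reflexive (length-reverse t)) (palLength≤-length (reverse t))) (n≤1+n _)

  -- The condition on the factor straddling the cut under which removing the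
  -- suffix t costs at most B extra palindromes.
  Trimmable : ℕ → List A → Set
  Trimmable B t = ∀ {s t₁ r} → t ≡ t₁ ++ r → IsPalindrome (s ++ t₁) → PalLength≤ s (suc B)

  trimmable-length : ∀ t → Trimmable (length t) t
  trimmable-length .(t₁ ++ r) {t₁ = t₁} {r} refl pal =
    palLength≤-mono (s≤s (length-++-≤ˡ t₁)) (palLength≤-prefixOfPalindrome-length pal)

  trimmable-yyz : ∀ y z → Trimmable 2 (y ∷ y ∷ z ∷ [])
  trimmable-yyz y z {t₁ = []}                  _    pal = palLength≤-mono (s≤s z≤n) (palLength≤-prefixOfPalindrome-length pal)
  trimmable-yyz y z {t₁ = _ ∷ []}              refl pal = palLength≤-mono (s≤s (s≤s z≤n)) (palLength≤-prefixOfPalindrome-length pal)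
  trimmable-yyz y z {t₁ = _ ∷ _ ∷ []}          refl pal = palLength≤-prefixOfPalindrome-length pal
  trimmable-yyz y z {t₁ = _ ∷ _ ∷ _ ∷ []}      refl pal =
    palLength≤-prefixOfPalindrome pal ([ z ] ∷ (y ∷ y ∷ []) ∷ [] , refl ∷ refl ∷ [] , refl , ≤-refl) ≤-refl
  trimmable-yyz y z {t₁ = _ ∷ _ ∷ _ ∷ _ ∷ _} () _

  palLength≤-dropSuffix : ∀ {B t w b} → Trimmable B t → PalLength≤ (w ++ t) b → PalLength≤ w (b + B)
  palLength≤-dropSuffix {B} {t} trim (ps , pal , eq , len) =
    palLength≤-mono (+-monoˡ-≤ B len) (factors ps _ pal eq)
    where
    factors : ∀ ps w → All IsPalindrome ps → concat ps ≡ w ++ t → PalLength≤ w (length ps + B)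
    factors []       [] []           _  = [] , [] , refl , z≤n
    factors (p ∷ ps) w  (palp ∷ pal) eq with ++-overlap p (concat ps) w t eq
    ... | inj₁ (v , refl , rest) with factors ps v pal rest
    ...   | qs , palqs , eqqs , lenqs = p ∷ qs , palp ∷ palqs , cong (p ++_) eqqs , s≤s lenqs
    factors (p ∷ ps) w  (palp ∷ pal) eq | inj₂ (t₁ , refl , t≡t₁r) =
      palLength≤-mono (s≤s (m≤n+m B (length ps))) (trim t≡t₁r palp)

  prefix-suc : ∀ (a : ℕ → A) n → prefix a (suc n) ≡ a 0 ∷ prefix (λ i → a (suc i)) n
  prefix-suc a n = cong (a 0 ∷_) (trans (map-applyUpTo suc a n) (sym (map-upTo (λ i → a (suc i)) n)))

  prefix-∷ʳ : ∀ (a : ℕ → A) m n → prefix a (m + suc n) ≡ prefix a (m + n) ∷ʳ a (m + n)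
  prefix-∷ʳ a m n = begin
    map a (upTo (m + suc n))          ≡⟨ cong (map a ∘′ upTo) (+-suc m n) ⟩
    map a (upTo (suc (m + n)))        ≡⟨ cong (map a) (upTo-∷ʳ (m + n)) ⟨
    map a (upTo (m + n) ∷ʳ (m + n))   ≡⟨ map-++ a (upTo (m + n)) [ m + n ] ⟩
    prefix a (m + n) ∷ʳ a (m + n)     ∎
    where open ≡-Reasoning

  EqualMiddles : List A → Set
  EqualMiddles []                    = ⊤
  EqualMiddles (_ ∷ b ∷ c ∷ _ ∷ w)   = c ≡ b × EqualMiddles w
  EqualMiddles _                     = ⊥

  equalMiddles-++ : ∀ u {v} → EqualMiddles u → EqualMiddles v → EqualMiddles (u ++ v)
  equalMiddles-++ []                    _          ev = ev
  equalMiddles-++ (_ ∷ _ ∷ _ ∷ _ ∷ u)   (c≡b , eu) ev = c≡b , equalMiddles-++ u eu ev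

  equalMiddles-map : ∀ (g : A → A) u → EqualMiddles u → EqualMiddles (map g u)
  equalMiddles-map g []                    _          = tt
  equalMiddles-map g (_ ∷ _ ∷ _ ∷ _ ∷ u)   (c≡b , eu) = cong g c≡b , equalMiddles-map g u eu

  prefix-4+ : ∀ (a : ℕ → A) L → prefix a (4 + L) ≡ a 0 ∷ a 1 ∷ a 2 ∷ a 3 ∷ prefix (λ i → a (4 + i)) L
  prefix-4+ a L = begin
    prefix a (4 + L)                                         ≡⟨ prefix-suc a (3 + L) ⟩
    a 0 ∷ prefix (λ i → a (1 + i)) (3 + L)                   ≡⟨ cong (a 0 ∷_) (prefix-suc _ (2 + L)) ⟩
    a 0 ∷ a 1 ∷ prefix (λ i → a (2 + i)) (2 + L)             ≡⟨ cong (λ w → a 0 ∷ a 1 ∷ w) (prefix-suc _ (1 + L)) ⟩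
    a 0 ∷ a 1 ∷ a 2 ∷ prefix (λ i → a (3 + i)) (1 + L)       ≡⟨ cong (λ w → a 0 ∷ a 1 ∷ a 2 ∷ w) (prefix-suc _ L) ⟩
    a 0 ∷ a 1 ∷ a 2 ∷ a 3 ∷ prefix (λ i → a (4 + i)) L       ∎
    where open ≡-Reasoning

  equalMiddles-prefix : ∀ (a : ℕ → A) k {L} → EqualMiddles (prefix a L) → 4 + 4 * k ≤ L →
    a (4 * k + 2) ≡ a (4 * k + 1)
  equalMiddles-prefix a zero    {suc (suc (suc (suc L)))} em _ = proj₁ (subst EqualMiddles (prefix-4+ a L) em)
  equalMiddles-prefix a (suc k) {suc (suc (suc (suc L)))} em (s≤s (s≤s (s≤s (s≤s 4k≤L)))) =
    subst₂ (λ i j → a i ≡ a j) (shift 2) (shift 1)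
      (equalMiddles-prefix (λ i → a (4 + i)) k (proj₂ (subst EqualMiddles (prefix-4+ a L) em))
        (subst (_≤ L) (*-suc 4 k) 4k≤L))
    where
    shift : ∀ i → 4 + (4 * k + i) ≡ 4 * suc k + i
    shift i = trans (sym (+-assoc 4 (4 * k) i)) (cong (_+ i) (sym (*-suc 4 k)))

module _ {n : ℕ} (x : Fin n) (f : ℕ → Permutation′ n) where

  equalMiddles-wseq : ∀ j → EqualMiddles (wseq x f (suc j))
  equalMiddles-wseq zero    = refl , tt
  equalMiddles-wseq (suc j) =
    equalMiddles-++ w em (equalMiddles-++ (image g w) emg (equalMiddles-++ (image g w) emg em))
    where
    w : List (Fin n)
    w = wseq x f (suc j)
    g : Permutation′ n
    g = f (suc j)
    em : EqualMiddles w
    em = equalMiddles-wseq j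
    emg : EqualMiddles (image g w)
    emg = equalMiddles-map (g ⟨$⟩ʳ_) w em

  wseq-length : ∀ j → j < length (wseq x f j)
  wseq-length zero    = s≤s z≤n
  wseq-length (suc j) = begin-strict
    suc j                  ≤⟨ wseq-length j ⟩
    length w               <⟨ m<m+n (length w) 0<|rest| ⟩
    length w + length rest ≡⟨ length-++ w ⟨
    length (w ++ rest)     ∎
    where
    open ≤-Reasoning
    w : List (Fin n)
    w = wseq x f j
    rest : List (Fin n)
    rest = image (f j) w ++ image (f j) w ++ w
    0<|rest| : 0 < length rest
    0<|rest| = ≤-trans (≤-<-trans z≤n (wseq-length j))
                 (≤-trans (≤-reflexive (sym (length-map _ w))) (length-++-≤ˡ (image (f j) w)))

inClassC-equalMiddles : ∀ {n} {a : ℕ → Fin n} → InClassC a → ∀ k → a (4 * k + 2) ≡ a (4 * k + 1)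
inClassC-equalMiddles {a = a} (x , f , _ , isPrefix) k =
  equalMiddles-prefix a k (subst EqualMiddles (sym (isPrefix j)) (equalMiddles-wseq x f (3 + 4 * k)))
    (<⇒≤ (wseq-length x f j))
  where
  j : ℕ
  j = 4 + 4 * k

lemma6 : (n : ℕ) → 2 ≤ n → (a : ℕ → Fin n) → InClassC a →
    (k p0 p1 p2 p3 : ℕ) →
    PalLength (prefix a (4 * k + 1)) p0 →
    PalLength (prefix a (4 * k + 2)) p1 →
    PalLength (prefix a (4 * k + 3)) p2 →
    PalLength (prefix a (4 * k + 4)) p3 →
    (p0 ≤ p3 + 2) × (p1 ≤ p3 + 2) × (p2 ≤ p3 + 1)
lemma6 n _ a inC k p0 p1 p2 p3 pl0 pl1 pl2 pl3 =
  palLength-least pl0 (palLength≤-dropSuffix (trimmable-yyz y z) (optimal ends-yyz)) ,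
  palLength-least pl1 (palLength≤-dropSuffix (trimmable-length (u ∷ z ∷ [])) (optimal ends-uz)) ,
  palLength-least pl2 (palLength≤-dropSuffix (trimmable-length [ z ]) (optimal (prefix-∷ʳ a m 3)))
  where
  open ≡-Reasoning
  m : ℕ
  m = 4 * k
  y u z : Fin n
  y = a (m + 1)
  u = a (m + 2)
  z = a (m + 3)
  optimal : ∀ {w} → prefix a (m + 4) ≡ w → PalLength≤ w p3
  optimal eq = subst (λ w → PalLength≤ w p3) eq (palLength⇒palLength≤ pl3)
  ends-uz : prefix a (m + 4) ≡ prefix a (m + 2) ++ u ∷ z ∷ []
  ends-uz = begin
    prefix a (m + 4)                    ≡⟨ prefix-∷ʳ a m 3 ⟩
    prefix a (m + 3) ∷ʳ z               ≡⟨ cong (_∷ʳ z) (prefix-∷ʳ a m 2) ⟩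
    (prefix a (m + 2) ∷ʳ u) ∷ʳ z        ≡⟨ ++-assoc (prefix a (m + 2)) [ u ] [ z ] ⟩
    prefix a (m + 2) ++ u ∷ z ∷ []      ∎
  ends-yyz : prefix a (m + 4) ≡ prefix a (m + 1) ++ y ∷ y ∷ z ∷ []
  ends-yyz = begin
    prefix a (m + 4)                          ≡⟨ ends-uz ⟩
    prefix a (m + 2) ++ u ∷ z ∷ []            ≡⟨ cong (_++ u ∷ z ∷ []) (prefix-∷ʳ a m 1) ⟩
    (prefix a (m + 1) ∷ʳ y) ++ u ∷ z ∷ []     ≡⟨ ++-assoc (prefix a (m + 1)) [ y ] (u ∷ z ∷ []) ⟩
    prefix a (m + 1) ++ y ∷ u ∷ z ∷ []        ≡⟨ cong (λ c → prefix a (m + 1) ++ y ∷ c ∷ z ∷ []) (inClassC-equalMiddles inC k) ⟩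
    prefix a (m + 1) ++ y ∷ y ∷ z ∷ []        ∎
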